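{- Let $n, k \ge 0$ and let $w$ be a finite string over the alphabet $M_k = \{m_1,\ldots,m_{k+1}\}$. The following are equivalent: (1) $w$ is $n$-complete; (2) the letters of $w$ can be partitioned into $n$ subsequences, each equal to $m_1 m_2 \cdots m_{k+1}$; (3) $|u|_1 \ge |u|_2 \ge \cdots \ge |u|_{k+1} \ge 0$ for every prefix $u$ of $w$, and $|w|_1 = |w|_2 = \cdots = |w|_{k+1} = n$.
   Context: A system of $k$ stacks in series consists of an input queue, stacks $1,\ldots,k$, and an output queue. The move $m_1$ dequeues the front element of the input queue and pushes it onto stack 1; $m_i$ ($2 \le i \le k$) pops the top of stack $i-1$ and pushes it onto stack $i$; $m_{k+1}$ pops the top of stack $k$ and enqueues it onto the output queue. A string of moves is applied to a state (contents of all stacks and queues) one letter at a time; if some move is illegal (popping/dequeueing from an empty stack/queue) the result is a special illegal state. $I(n,k)$ is the state in which the input queue contains $1,\ldots,n$ (front to back) and all stacks and the output queue are empty. A string $w$ is $n$-complete if applying $w$ to $I(n,k)$ is legal and yields a final state, i.e. a state in which all elements are in the output queue. For a string $u$, $|u|_i$ denotes the number of occurrences of $m_i$ in $u$. -}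

module Defs where

open import Data.Nat using (ℕ; zero; suc; _≤_)
open import Data.Fin as Fin using (Fin; zero; suc; inject₁; fromℕ; toℕ)
open import Data.List as List using (List; []; _∷_; _++_; [_]; length; upTo; allFin; take)
open import Data.Vec as Vec using (Vec; lookup; updateAt; replicate; _[_]≔_)
open import Data.Maybe using (Maybe; just; nothing; _>>=_)
open import Data.Product using (Σ; ∃; _×_; _,_)
open import Relation.Nullary using (yes; no)
open import Relation.Binary.PropositionalEquality using (_≡_)

-- A move of the system of k stacks in series: the letter m_(i+1) is
-- represented by i : Fin (suc k), so zero = m_1, ..., fromℕ k = m_(k+1).
Move : ℕ → Set
Move k = Fin (suc k)

-- A state: positions 0 .. k+1.  Position 0 is the input queue (front = head),
-- positions 1..k are the stacks 1..k (top = head), and position k+1 is the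
-- output queue (front = head, enqueue at the end).
State : ℕ → Set
State k = Vec (List ℕ) (suc (suc k))

put : ∀ {k} → Fin (suc (suc k)) → ℕ → List ℕ → List ℕ
put {k} j x l with j Fin.≟ fromℕ (suc k)
... | yes _ = l ++ [ x ]
... | no _  = x ∷ l

move : ∀ {k} → Move k → State k → Maybe (State k)
move i s with lookup s (inject₁ i)
... | []     = nothing
... | x ∷ xs = just (updateAt (s [ inject₁ i ]≔ xs) (suc i) (put (suc i) x))

apply : ∀ {k} → List (Move k) → Maybe (State k) → Maybe (State k)
apply []       ms = ms
apply (m ∷ w)  ms = apply w (ms >>= move m)

initial : (n k : ℕ) → State k
initial n k = List.map suc (upTo n) Vec.∷ replicate (suc k) []

-- final state: every element is in the output queue, i.e. the input queue
-- and all stacks are empty.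
Final : ∀ {k} → State k → Set
Final {k} s = ∀ (j : Fin (suc k)) → lookup s (inject₁ j) ≡ []

Complete : (n k : ℕ) → List (Move k) → Set
Complete n k w = Σ (State k) λ s → apply w (just (initial n k)) ≡ just s × Final s

subseqAt : ∀ {A : Set} {m : ℕ} (w : List A) → (Fin (length w) → Fin m) → Fin m → List A
subseqAt [] c j = []
subseqAt (a ∷ w) c j with c zero Fin.≟ j
... | yes _ = a ∷ subseqAt w (λ i → c (suc i)) j
... | no _  = subseqAt w (λ i → c (suc i)) j

-- the letters of w can be partitioned into n subsequences each equal to
-- m_1 m_2 ... m_(k+1): a labelling of the positions of w by n classes such
-- that each class, read in order, is m_1 ... m_(k+1).
Partitionable : (n k : ℕ) → List (Move k) → Set
Partitionable n k w =
  Σ (Fin (length w) → Fin n) λ c → ∀ (j : Fin n) → subseqAt w c j ≡ allFin (suc k)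

-- |u|_(i+1): number of occurrences of the letter i in u
count : ∀ {k} → Move k → List (Move k) → ℕ
count i []      = 0
count i (a ∷ u) with a Fin.≟ i
... | yes _ = suc (count i u)
... | no _  = count i u

Ballot : (n k : ℕ) → List (Move k) → Set
Ballot n k w =
  (∀ (p : ℕ) → p ≤ length w → ∀ (i : Fin k) →
      count (suc i) (take p w) ≤ count (inject₁ i) (take p w))
  × (∀ (i : Fin (suc k)) → count i w ≡ n)

-- Only the number of elements at each position matters: a move m_(a+1) is
-- legal exactly when position a is nonempty, and then it shifts one token
-- from position a to position a+1.  All three conditions are therefore
-- statements about the occupancy profile v : ℕ → ℕ along w, starting from n
-- tokens at position 0, and each is equivalent to "w drains v", i.e. every
-- shift is legal and positions 0..k end up empty.
--   (1) The lengths of the lists in a state are its occupancy profile.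
--   (3) After a prefix u, position x holds v x + (arrivals into x) − (departures
--       from x); legality and drainage are the ballot inequalities and equalities.
--   (2) Regard the n subsequences as n tokens, token j being at stage σ j when
--       its next letter is m_(σ j + 1); the histogram of the stages is the
--       occupancy.  Conversely, to label a letter m_(a+1) pick any token at stage a.
module Submission where

open import Defs
open import Data.Nat using (ℕ)
open import Data.List using (List)
open import Data.Product using (_×_)
open import Function.Bundles using (_⇔_)

open import Data.Nat.Base using (zero; suc; _+_; _∸_; _≤_; _<_; z≤n; s≤s; z<s)
open import Data.Nat.Properties
open import Data.Nat.Tactic.RingSolver using (solve-∀)
open import Data.Fin as Fin using (Fin; zero; suc; toℕ; inject₁; fromℕ<)
import Data.Fin.Properties as Finₚ
open import Data.List.Base using ([]; _∷_; length; take; drop; allFin; tabulate; upTo)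
open import Data.List.Properties
  using (length-drop; length-tabulate; length-++; length-map; length-upTo; drop-all; ∷-injective)
open import Data.Vec.Base using (Vec; lookup; updateAt; _[_]≔_; replicate)
open import Data.Vec.Properties using (lookup∘updateAt; lookup∘updateAt′; lookup-replicate)
import Data.Vec.Functional as Vector
open import Data.Maybe.Base using (just; nothing)
open import Data.Product using (Σ; ∃; _,_; proj₁; proj₂)
open import Function.Base using (_∘_)
open import Function.Bundles using (mk⇔)
open import Function.Properties.Equivalence using () renaming (trans to ⇔-trans; sym to ⇔-sym)
open import Relation.Nullary using (yes; no; contradiction)
open import Relation.Binary.PropositionalEquality

δ : ℕ → ℕ → ℕ
δ zero    zero    = 1
δ zero    (suc _) = 0
δ (suc _) zero    = 0
δ (suc a) (suc b) = δ a b

δ-refl : ∀ a → δ a a ≡ 1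
δ-refl zero    = refl
δ-refl (suc a) = δ-refl a

δ-≢ : ∀ {a b} → a ≢ b → δ a b ≡ 0
δ-≢ {zero}  {zero}  a≢b = contradiction refl a≢b
δ-≢ {zero}  {suc b} _   = refl
δ-≢ {suc a} {zero}  _   = refl
δ-≢ {suc a} {suc b} a≢b = δ-≢ (a≢b ∘ cong suc)

δ-suc-self : ∀ a → δ (suc a) a ≡ 0
δ-suc-self a = δ-≢ {suc a} {a} 1+n≢n

+-swap-outer : ∀ a t b → (a + t) + b ≡ (b + t) + a
+-swap-outer = solve-∀

-- Occupancy profiles and shifts

-- v′ arises from v by moving one token from position a to position a+1.
Shift : ℕ → (ℕ → ℕ) → (ℕ → ℕ) → Set
Shift a v v′ = ∀ x → v′ x + δ a x ≡ v x + δ (suc a) x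

module _ {a : ℕ} {v v′ : ℕ → ℕ} where

  Shift-source : Shift a v v′ → v a ≡ suc (v′ a)
  Shift-source sh = begin
    v a                   ≡⟨ sym (+-identityʳ (v a)) ⟩
    v a + 0               ≡⟨ cong (v a +_) (sym (δ-suc-self a)) ⟩
    v a + δ (suc a) a     ≡⟨ sym (sh a) ⟩
    v′ a + δ a a          ≡⟨ cong (v′ a +_) (δ-refl a) ⟩
    v′ a + 1              ≡⟨ +-comm (v′ a) 1 ⟩
    suc (v′ a)            ∎
    where open ≡-Reasoning

  Shift-respˡ : ∀ {u} → v ≗ u → Shift a v v′ → Shift a u v′
  Shift-respˡ v≗u sh x = trans (sh x) (cong (_+ δ (suc a) x) (v≗u x))

  Shift-functional : ∀ {u u′} → Shift a v v′ → Shift a u u′ → v ≗ u → v′ ≗ u′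
  Shift-functional sh sh′ v≗u x =
    +-cancelʳ-≡ (δ a x) _ _ (trans (sh x) (trans (cong (_+ _) (v≗u x)) (sym (sh′ x))))

  Shift-rebalance : Shift a v v′ → ∀ x A → v x + (δ (suc a) x + A) ≡ δ a x + (v′ x + A)
  Shift-rebalance sh x A = begin
    v x + (δ (suc a) x + A)   ≡⟨ sym (+-assoc (v x) _ A) ⟩
    (v x + δ (suc a) x) + A   ≡⟨ cong (_+ A) (sym (sh x)) ⟩
    (v′ x + δ a x) + A        ≡⟨ cong (_+ A) (+-comm (v′ x) _) ⟩
    (δ a x + v′ x) + A        ≡⟨ +-assoc (δ a x) (v′ x) A ⟩
    δ a x + (v′ x + A)        ∎
    where open ≡-Reasoning

shift : ℕ → (ℕ → ℕ) → ℕ → ℕ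
shift a v x = v x + δ (suc a) x ∸ δ a x

shift-Shift : ∀ {a v} → 0 < v a → Shift a v (shift a v)
shift-Shift {a} {v} occupied x = m∸n+n≡m (≤-trans (departing x) (m≤m+n (v x) _))
  where
    departing : ∀ x → δ a x ≤ v x
    departing x with a ≟ x
    ... | yes refl = subst (_≤ v a) (sym (δ-refl a)) occupied
    ... | no a≢x   = subst (_≤ v x) (sym (δ-≢ a≢x)) z≤n

initialOccupancy : ℕ → ℕ → ℕ
initialOccupancy n zero    = n
initialOccupancy n (suc _) = 0

data Drains {k : ℕ} (v : ℕ → ℕ) : List (Move k) → Set where
  drained : (∀ x → x ≤ k → v x ≡ 0) → Drains v []
  step    : ∀ {i w} v′ → Shift (toℕ i) v v′ → Drains v′ w → Drains v (i ∷ w)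

-- (1) n-completeness

occupancy : ∀ {m} → Vec (List ℕ) m → ℕ → ℕ
occupancy Vec.[]     x       = 0
occupancy (l Vec.∷ s) zero    = length l
occupancy (l Vec.∷ s) (suc x) = occupancy s x

occupancy-lookup : ∀ {m} (s : Vec (List ℕ) m) j → occupancy s (toℕ j) ≡ length (lookup s j)
occupancy-lookup (l Vec.∷ s) zero    = refl
occupancy-lookup (l Vec.∷ s) (suc j) = occupancy-lookup s j

occupancy-push : ∀ {m} (s : Vec (List ℕ) m) j {f} → (∀ l → length (f l) ≡ suc (length l)) →
                 ∀ x → occupancy (updateAt s j f) x ≡ δ (toℕ j) x + occupancy s x
occupancy-push (l Vec.∷ s) zero    grows zero    = grows l
occupancy-push (l Vec.∷ s) zero    grows (suc x) = refl
occupancy-push (l Vec.∷ s) (suc j) grows zero    = refl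
occupancy-push (l Vec.∷ s) (suc j) grows (suc x) = occupancy-push s j grows x

occupancy-pop : ∀ {m} (s : Vec (List ℕ) m) j {y ys} → lookup s j ≡ y ∷ ys →
                ∀ x → occupancy s x ≡ δ (toℕ j) x + occupancy (s [ j ]≔ ys) x
occupancy-pop (l Vec.∷ s) zero    eq zero    = cong length eq
occupancy-pop (l Vec.∷ s) zero    eq (suc x) = refl
occupancy-pop (l Vec.∷ s) (suc j) eq zero    = refl
occupancy-pop (l Vec.∷ s) (suc j) eq (suc x) = occupancy-pop s j eq x

occupancy-initial : ∀ n k → occupancy (initial n k) ≗ initialOccupancy n
occupancy-initial n k zero    = trans (length-map suc (upTo n)) (length-upTo n)
occupancy-initial n k (suc x) = replicate-empty (suc k) x
  where
    replicate-empty : ∀ m x → occupancy (replicate m []) x ≡ 0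
    replicate-empty zero    x       = refl
    replicate-empty (suc m) zero    = refl
    replicate-empty (suc m) (suc x) = replicate-empty m x

length-put : ∀ {k} (j : Fin (suc (suc k))) y l → length (put j y l) ≡ suc (length l)
length-put {k} j y l with j Fin.≟ Fin.fromℕ (suc k)
... | yes _ = trans (length-++ l) (+-comm (length l) 1)
... | no _  = refl

module _ {k : ℕ} where

  move-Shift : ∀ (i : Move k) (s : State k) {y ys} → lookup s (inject₁ i) ≡ y ∷ ys →
               Shift (toℕ i) (occupancy s)
                     (occupancy (updateAt (s [ inject₁ i ]≔ ys) (suc i) (put (suc i) y)))
  move-Shift i s {y} {ys} eq x = begin
    occupancy s′ x + δ a x
      ≡⟨ cong (_+ δ a x) (occupancy-push t (suc i) (length-put (suc i) y) x) ⟩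
    (δ (suc a) x + occupancy t x) + δ a x
      ≡⟨ +-swap-outer (δ (suc a) x) _ _ ⟩
    (δ a x + occupancy t x) + δ (suc a) x
      ≡⟨ cong (λ b → (δ b x + occupancy t x) + δ (suc a) x) (sym (Finₚ.toℕ-inject₁ i)) ⟩
    (δ (toℕ (inject₁ i)) x + occupancy t x) + δ (suc a) x
      ≡⟨ cong (_+ δ (suc a) x) (sym (occupancy-pop s (inject₁ i) eq x)) ⟩
    occupancy s x + δ (suc a) x
      ∎
    where
      open ≡-Reasoning
      a  = toℕ i
      t  = s [ inject₁ i ]≔ ys
      s′ = updateAt t (suc i) (put (suc i) y)

  data MoveView (i : Move k) (s : State k) : Set where
    blocked : occupancy s (toℕ i) ≡ 0 → move i s ≡ nothing → MoveView i s
    moves   : ∀ s′ → move i s ≡ just s′ → Shift (toℕ i) (occupancy s) (occupancy s′) → MoveView i s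

  move-[] : ∀ (i : Move k) (s : State k) → lookup s (inject₁ i) ≡ [] → move i s ≡ nothing
  move-[] i s eq with lookup s (inject₁ i)
  ... | [] = refl

  move-∷ : ∀ (i : Move k) (s : State k) {y ys} → lookup s (inject₁ i) ≡ y ∷ ys →
           move i s ≡ just (updateAt (s [ inject₁ i ]≔ ys) (suc i) (put (suc i) y))
  move-∷ i s eq with lookup s (inject₁ i)
  ... | _ ∷ _ with refl ← eq = refl

  moveView : ∀ i s → MoveView i s
  moveView i s with lookup s (inject₁ i) in eq
  ... | []     = blocked (trans (cong (occupancy s) (sym (Finₚ.toℕ-inject₁ i)))
                                (trans (occupancy-lookup s (inject₁ i)) (cong length eq)))
                         (move-[] i s eq)
  ... | y ∷ ys = moves _ (move-∷ i s eq) (move-Shift i s eq)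

  apply-nothing : ∀ (w : List (Move k)) → apply w nothing ≡ nothing
  apply-nothing []      = refl
  apply-nothing (_ ∷ w) = apply-nothing w

  Final⇒vacant : ∀ (s : State k) → Final s → ∀ x → x ≤ k → occupancy s x ≡ 0
  Final⇒vacant s final x x≤k = begin
    occupancy s x                       ≡⟨ cong (occupancy s) (sym toℕ-j) ⟩
    occupancy s (toℕ (inject₁ j))       ≡⟨ occupancy-lookup s (inject₁ j) ⟩
    length (lookup s (inject₁ j))       ≡⟨ cong length (final j) ⟩
    0                                   ∎
    where
      open ≡-Reasoning
      j = fromℕ< (s≤s x≤k)
      toℕ-j : toℕ (inject₁ j) ≡ x
      toℕ-j = trans (Finₚ.toℕ-inject₁ j) (Finₚ.toℕ-fromℕ< (s≤s x≤k))

  vacant⇒Final : ∀ (s : State k) → (∀ x → x ≤ k → occupancy s x ≡ 0) → Final s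
  vacant⇒Final s vacant j = length≡0⇒[] (trans (sym (occupancy-lookup s (inject₁ j))) (vacant _ toℕ-j≤k))
    where
      toℕ-j≤k : toℕ (inject₁ j) ≤ k
      toℕ-j≤k = subst (_≤ k) (sym (Finₚ.toℕ-inject₁ j)) (Finₚ.toℕ≤pred[n] j)
      length≡0⇒[] : ∀ {l : List ℕ} → length l ≡ 0 → l ≡ []
      length≡0⇒[] {[]} _ = refl

  complete⇒drains : ∀ {v} w (s : State k) {s′} → apply w (just s) ≡ just s′ → Final s′ →
                    occupancy s ≗ v → Drains v w
  complete⇒drains []      s refl    final s≗v =
    drained λ x x≤k → trans (sym (s≗v x)) (Final⇒vacant s final x x≤k)
  complete⇒drains (i ∷ w) s reaches final s≗v with moveView i s
  ... | blocked _ stuck =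
    contradiction (trans (sym (apply-nothing w)) (trans (cong (apply w) (sym stuck)) reaches)) λ ()
  ... | moves s″ moved sh =
    step (occupancy s″) (Shift-respˡ s≗v sh)
         (complete⇒drains w s″ (trans (cong (apply w) (sym moved)) reaches) final λ _ → refl)

  drains⇒complete : ∀ {v} {w : List (Move k)} → Drains v w → ∀ s → occupancy s ≗ v →
                    Σ (State k) λ s′ → apply w (just s) ≡ just s′ × Final s′
  drains⇒complete (drained vacant) s s≗v =
    s , refl , vacant⇒Final s λ x x≤k → trans (s≗v x) (vacant x x≤k)
  drains⇒complete (step {i} {w} v′ sh d) s s≗v with moveView i s
  ... | blocked empty _ = contradiction (trans (sym empty) (trans (s≗v _) (Shift-source sh))) 0≢1+n
  ... | moves s″ moved sh′ =
    let s′ , reaches , final = drains⇒complete d s″ (Shift-functional sh′ sh s≗v)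
    in  s′ , trans (cong (apply w) moved) reaches , final

complete⇔drains : ∀ n k (w : List (Move k)) → Complete n k w ⇔ Drains (initialOccupancy n) w
complete⇔drains n k w = mk⇔
  (λ (_ , reaches , final) → complete⇒drains w (initial n k) reaches final (occupancy-initial n k))
  (λ d → drains⇒complete d (initial n k) (occupancy-initial n k))

-- (3) the ballot condition

departures : ∀ {k} → ℕ → List (Move k) → ℕ
departures x []      = 0
departures x (i ∷ u) = δ (toℕ i) x + departures x u

arrivals : ∀ {k} → ℕ → List (Move k) → ℕ
arrivals x []      = 0
arrivals x (i ∷ u) = δ (suc (toℕ i)) x + arrivals x u

module _ {k : ℕ} where

  arrivals-zero : ∀ (u : List (Move k)) → arrivals 0 u ≡ 0
  arrivals-zero []      = refl
  arrivals-zero (_ ∷ u) = arrivals-zero u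

  arrivals-suc : ∀ x (u : List (Move k)) → arrivals (suc x) u ≡ departures x u
  arrivals-suc x []      = refl
  arrivals-suc x (i ∷ u) = cong (δ (toℕ i) x +_) (arrivals-suc x u)

  departures-take : ∀ x p (u : List (Move k)) → departures x (take p u) ≤ departures x u
  departures-take x zero    u       = z≤n
  departures-take x (suc p) []      = z≤n
  departures-take x (suc p) (i ∷ u) = +-monoʳ-≤ (δ (toℕ i) x) (departures-take x p u)

  count≡departures : ∀ (i : Move k) u → count i u ≡ departures (toℕ i) u
  count≡departures i []      = refl
  count≡departures i (a ∷ u) with a Fin.≟ i
  ... | yes refl = cong₂ _+_ (sym (δ-refl (toℕ a))) (count≡departures i u)
  ... | no a≢i   = cong₂ _+_ (sym (δ-≢ (a≢i ∘ Finₚ.toℕ-injective))) (count≡departures i u)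

  BallotFrom : (ℕ → ℕ) → List (Move k) → Set
  BallotFrom v w =
    (∀ p → p ≤ length w → ∀ x → x ≤ k → departures x (take p w) ≤ v x + arrivals x (take p w))
    × (∀ x → x ≤ k → departures x w ≡ v x + arrivals x w)

  drains⇒ballotFrom : ∀ {v w} → Drains v w → BallotFrom v w
  drains⇒ballotFrom {v} (drained vacant) = prefix , λ x x≤k → sym (trans (+-identityʳ (v x)) (vacant x x≤k))
    where
      prefix : ∀ p → p ≤ 0 → ∀ x → x ≤ k → departures x (take p []) ≤ v x + arrivals x (take p [])
      prefix zero _ _ _ = z≤n
  drains⇒ballotFrom {v} (step {i} {w} v′ sh d) = prefix , total
    where
      a = toℕ i
      ballot = drains⇒ballotFrom d
      prefix : ∀ p → p ≤ suc (length w) → ∀ x → x ≤ k →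
               departures x (take p (i ∷ w)) ≤ v x + arrivals x (take p (i ∷ w))
      prefix zero    _         _ _   = z≤n
      prefix (suc p) (s≤s p≤w) x x≤k = subst (δ a x + departures x (take p w) ≤_) (sym (Shift-rebalance sh x _))
                                             (+-monoʳ-≤ (δ a x) (proj₁ ballot p p≤w x x≤k))
      total : ∀ x → x ≤ k → departures x (i ∷ w) ≡ v x + arrivals x (i ∷ w)
      total x x≤k = trans (cong (δ a x +_) (proj₂ ballot x x≤k)) (sym (Shift-rebalance sh x _))

  ballotFrom⇒drains : ∀ {v} w → BallotFrom v w → Drains v w
  ballotFrom⇒drains {v} []      (_ , total) =
    drained λ x x≤k → trans (sym (+-identityʳ (v x))) (sym (total x x≤k))
  ballotFrom⇒drains {v} (i ∷ w) (prefix , total) =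
    step (shift a v) sh (ballotFrom⇒drains w (prefix′ , total′))
    where
      a = toℕ i
      -- the prefix of length one says 1 ≤ v a
      occupied : 0 < v a
      occupied = subst₂ _≤_ (cong (_+ 0) (δ-refl a))
                   (trans (cong (λ d → v a + (d + 0)) (δ-suc-self a)) (+-identityʳ (v a)))
                   (prefix 1 (s≤s z≤n) a (Finₚ.toℕ≤pred[n] i))
      sh = shift-Shift occupied
      prefix′ : ∀ p → p ≤ length w → ∀ x → x ≤ k →
                departures x (take p w) ≤ shift a v x + arrivals x (take p w)
      prefix′ p p≤w x x≤k = +-cancelˡ-≤ (δ a x) _ _
        (subst (δ a x + departures x (take p w) ≤_) (Shift-rebalance sh x _) (prefix (suc p) (s≤s p≤w) x x≤k))
      total′ : ∀ x → x ≤ k → departures x w ≡ shift a v x + arrivals x w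
      total′ x x≤k = +-cancelˡ-≡ (δ a x) _ _ (trans (total x x≤k) (Shift-rebalance sh x _))

n+arrivals-zero : ∀ n {k} (u : List (Move k)) → n + arrivals 0 u ≡ n
n+arrivals-zero n u = trans (cong (n +_) (arrivals-zero u)) (+-identityʳ n)

module _ (n : ℕ) {k : ℕ} (w : List (Move k)) where

  ballot⇒ballotFrom : Ballot n k w → BallotFrom (initialOccupancy n) w
  ballot⇒ballotFrom (ordered , counts) = prefix , total
    where
      all-n : ∀ x → x ≤ k → departures x w ≡ n
      all-n x x≤k = trans (cong (λ y → departures y w) (sym (Finₚ.toℕ-fromℕ< (s≤s x≤k))))
                          (trans (sym (count≡departures _ w)) (counts _))
      prefix : ∀ p → p ≤ length w → ∀ x → x ≤ k →
               departures x (take p w) ≤ initialOccupancy n x + arrivals x (take p w)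
      prefix p p≤w zero    _     =
        ≤-trans (departures-take 0 p w) (≤-reflexive (trans (all-n 0 z≤n) (sym (n+arrivals-zero n (take p w)))))
      prefix p p≤w (suc x) 1+x≤k = subst₂ _≤_
        (trans (count≡departures (suc i) u) (cong (λ y → departures (suc y) u) toℕ-i))
        (trans (count≡departures (inject₁ i) u)
               (trans (cong (λ y → departures y u) (trans (Finₚ.toℕ-inject₁ i) toℕ-i))
                      (sym (arrivals-suc x u))))
        (ordered p p≤w i)
        where
          i = fromℕ< 1+x≤k
          toℕ-i = Finₚ.toℕ-fromℕ< 1+x≤k
          u = take p w
      total : ∀ x → x ≤ k → departures x w ≡ initialOccupancy n x + arrivals x w
      total zero    _     = trans (all-n 0 z≤n) (sym (n+arrivals-zero n w))
      total (suc x) 1+x≤k = trans (all-n (suc x) 1+x≤k)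
                                  (sym (trans (arrivals-suc x w) (all-n x (≤-trans (n≤1+n x) 1+x≤k))))

  ballotFrom⇒ballot : BallotFrom (initialOccupancy n) w → Ballot n k w
  ballotFrom⇒ballot (prefix , total) = ordered , counts
    where
      all-n : ∀ x → x ≤ k → departures x w ≡ n
      all-n zero    _     = trans (total 0 z≤n) (n+arrivals-zero n w)
      all-n (suc x) 1+x≤k = trans (total (suc x) 1+x≤k)
                                  (trans (arrivals-suc x w) (all-n x (≤-trans (n≤1+n x) 1+x≤k)))
      ordered : ∀ p → p ≤ length w → ∀ (i : Fin k) →
                count (suc i) (take p w) ≤ count (inject₁ i) (take p w)
      ordered p p≤w i = subst₂ _≤_
        (sym (count≡departures (suc i) u))
        (trans (arrivals-suc (toℕ i) u)
               (trans (cong (λ y → departures y u) (sym (Finₚ.toℕ-inject₁ i)))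
                      (sym (count≡departures (inject₁ i) u))))
        (prefix p p≤w (suc (toℕ i)) (Finₚ.toℕ<n i))
        where u = take p w
      counts : ∀ i → count i w ≡ n
      counts i = trans (count≡departures i w) (all-n (toℕ i) (Finₚ.toℕ≤pred[n] i))

ballot⇔drains : ∀ n k (w : List (Move k)) → Ballot n k w ⇔ Drains (initialOccupancy n) w
ballot⇔drains n k w = mk⇔ (ballotFrom⇒drains w ∘ ballot⇒ballotFrom n w)
                          (ballotFrom⇒ballot n w ∘ drains⇒ballotFrom)

-- (2) partitions into copies of m_1 ⋯ m_(k+1)

hist : ∀ {n} → Vec ℕ n → ℕ → ℕ
hist Vec.[]      x = 0
hist (s Vec.∷ σ) x = δ s x + hist σ x

hist-advance : ∀ {n} (σ : Vec ℕ n) j → Shift (lookup σ j) (hist σ) (hist (updateAt σ j suc))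
hist-advance (s Vec.∷ σ) zero    x = +-swap-outer (δ (suc s) x) (hist σ x) (δ s x)
hist-advance (s Vec.∷ σ) (suc j) x =
  trans (+-assoc (δ s x) _ _)
        (trans (cong (δ s x +_) (hist-advance σ j x)) (sym (+-assoc (δ s x) _ _)))

hist-lookup : ∀ {n} (σ : Vec ℕ n) j → 0 < hist σ (lookup σ j)
hist-lookup (s Vec.∷ σ) zero    = subst (λ d → 0 < d + hist σ s) (sym (δ-refl s)) z<s
hist-lookup (s Vec.∷ σ) (suc j) = ≤-trans (hist-lookup σ j) (m≤n+m _ (δ s _))

hist-occupied : ∀ {n} (σ : Vec ℕ n) {x} → 0 < hist σ x → ∃ λ j → lookup σ j ≡ x
hist-occupied (s Vec.∷ σ) {x} occupied with s ≟ x
... | yes s≡x = zero , s≡x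
... | no s≢x  =
  let j , σj≡x = hist-occupied σ (subst (λ d → 0 < d + hist σ x) (δ-≢ s≢x) occupied) in suc j , σj≡x

hist-replicate : ∀ n → hist (replicate n 0) ≗ initialOccupancy n
hist-replicate zero    zero    = refl
hist-replicate zero    (suc x) = refl
hist-replicate (suc n) zero    = cong suc (hist-replicate n zero)
hist-replicate (suc n) (suc x) = hist-replicate n (suc x)

drop-tabulate : ∀ {A : Set} {n} (f : Fin n → A) i →
                drop (toℕ i) (tabulate f) ≡ f i ∷ drop (suc (toℕ i)) (tabulate f)
drop-tabulate f zero    = refl
drop-tabulate f (suc i) = drop-tabulate (f ∘ suc) i

subseqAt-here : ∀ {A : Set} {m} a (w : List A) (c : Fin (suc (length w)) → Fin m) {j} →
                c zero ≡ j → subseqAt (a ∷ w) c j ≡ a ∷ subseqAt w (Vector.tail c) j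
subseqAt-here a w c {j} c₀≡j with c zero Fin.≟ j
... | yes _     = refl
... | no c₀≢j   = contradiction c₀≡j c₀≢j

subseqAt-there : ∀ {A : Set} {m} a (w : List A) (c : Fin (suc (length w)) → Fin m) {j} →
                 c zero ≢ j → subseqAt (a ∷ w) c j ≡ subseqAt w (Vector.tail c) j
subseqAt-there a w c {j} c₀≢j with c zero Fin.≟ j
... | yes c₀≡j = contradiction c₀≡j c₀≢j
... | no _     = refl

module _ {k : ℕ} where

  -- the letters still to be read by a token at stage m
  suffix : ℕ → List (Move k)
  suffix m = drop m (allFin (suc k))

  suffix-toℕ : ∀ i → suffix (toℕ i) ≡ i ∷ suffix (suc (toℕ i))
  suffix-toℕ = drop-tabulate (λ i → i)

  length-suffix : ∀ m → length (suffix m) ≡ suc k ∸ m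
  length-suffix m = trans (length-drop m (allFin (suc k))) (cong (_∸ m) (length-tabulate (λ i → i)))

  suffix-≥ : ∀ {m} → suc k ≤ m → suffix m ≡ []
  suffix-≥ {m} k<m = drop-all m _ (≤-trans (≤-reflexive (length-tabulate (λ i → i))) k<m)

  suffix≡[]⇒≥ : ∀ {m} → suffix m ≡ [] → suc k ≤ m
  suffix≡[]⇒≥ {m} e = m∸n≡0⇒m≤n (trans (sym (length-suffix m)) (cong length e))

  suffix≡∷⇒ : ∀ {m i r} → suffix m ≡ i ∷ r → m ≡ toℕ i × r ≡ suffix (suc m)
  suffix≡∷⇒ {m} {i} {r} e = trans (sym toℕ-j) (cong toℕ (proj₁ heads)) , sym (proj₂ heads)
    where
      m<1+k : m < suc k
      m<1+k = m∸n≢0⇒n<m λ k∸m≡0 → 0≢1+n (trans (sym k∸m≡0) (trans (sym (length-suffix m)) (cong length e)))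
      j = fromℕ< m<1+k
      toℕ-j = Finₚ.toℕ-fromℕ< m<1+k
      heads : j ≡ i × suffix (suc m) ≡ r
      heads = ∷-injective (trans (sym (subst (λ t → suffix t ≡ j ∷ suffix (suc t)) toℕ-j (suffix-toℕ j))) e)

  Staged : ∀ {n} (w : List (Move k)) → (Fin (length w) → Fin n) → Vec ℕ n → Set
  Staged w c σ = ∀ j → subseqAt w c j ≡ suffix (lookup σ j)

  staged⇒drains : ∀ {n v} w (c : Fin (length w) → Fin n) σ → Staged w c σ → hist σ ≗ v → Drains v w
  staged⇒drains {v = v} [] c σ staged σ≗v = drained vacant
    where
      vacant : ∀ x → x ≤ k → v x ≡ 0
      vacant x x≤k = trans (sym (σ≗v x)) (n≤0⇒n≡0 (≮⇒≥ λ occupied →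
        let j , σj≡x = hist-occupied σ occupied
        in  ≤⇒≯ x≤k (subst (suc k ≤_) σj≡x (suffix≡[]⇒≥ (sym (staged j))))))
  staged⇒drains (i ∷ w) c σ staged σ≗v =
    step (hist σ′) (Shift-respˡ σ≗v advance) (staged⇒drains w (Vector.tail c) σ′ staged′ λ _ → refl)
    where
      j₀ = c zero
      σ′ = updateAt σ j₀ suc
      next = suffix≡∷⇒ (trans (sym (staged j₀)) (subseqAt-here i w c refl))
      advance : Shift (toℕ i) (hist σ) (hist σ′)
      advance = subst (λ a → Shift a (hist σ) (hist σ′)) (proj₁ next) (hist-advance σ j₀)
      staged′ : Staged w (Vector.tail c) σ′
      staged′ j with j Fin.≟ j₀
      ... | yes refl = trans (proj₂ next) (cong suffix (sym (lookup∘updateAt j₀ σ)))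
      ... | no j≢j₀  = trans (sym (subseqAt-there i w c (j≢j₀ ∘ sym)))
                             (trans (staged j) (cong suffix (sym (lookup∘updateAt′ j j₀ j≢j₀ σ))))

  drains⇒staged : ∀ {n v w} → Drains v w → (σ : Vec ℕ n) → hist σ ≗ v →
                  Σ (Fin (length w) → Fin n) λ c → Staged w c σ
  drains⇒staged (drained vacant) σ σ≗v = (λ ()) , λ j → sym (suffix-≥ (finished j))
    where
      finished : ∀ j → suc k ≤ lookup σ j
      finished j = ≰⇒> λ σj≤k → <⇒≢ (hist-lookup σ j) (sym (trans (σ≗v _) (vacant _ σj≤k)))
  drains⇒staged (step {i} {w} v′ sh d) σ σ≗v = j₀ Vector.∷ c , staged
    where
      found = hist-occupied σ (subst (0 <_) (sym (trans (σ≗v _) (Shift-source sh))) z<s)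
      j₀ = proj₁ found
      σj₀≡i = proj₂ found
      σ′ = updateAt σ j₀ suc
      advance : Shift (toℕ i) (hist σ) (hist σ′)
      advance = subst (λ a → Shift a (hist σ) (hist σ′)) σj₀≡i (hist-advance σ j₀)
      rest = drains⇒staged d σ′ (Shift-functional advance sh σ≗v)
      c = proj₁ rest
      -- Splitting on j₀ ≟ j also decides the case split inside subseqAt.
      staged : Staged (i ∷ w) (j₀ Vector.∷ c) σ
      staged j with j₀ Fin.≟ j
      ... | yes refl = begin
        i ∷ subseqAt w c j₀                  ≡⟨ cong (i ∷_) (proj₂ rest j₀) ⟩
        i ∷ suffix (lookup σ′ j₀)            ≡⟨ cong (λ m → i ∷ suffix m) (lookup∘updateAt j₀ σ) ⟩
        i ∷ suffix (suc (lookup σ j₀))       ≡⟨ cong (λ m → i ∷ suffix (suc m)) σj₀≡i ⟩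
        i ∷ suffix (suc (toℕ i))             ≡⟨ sym (suffix-toℕ i) ⟩
        suffix (toℕ i)                       ≡⟨ cong suffix (sym σj₀≡i) ⟩
        suffix (lookup σ j₀)                 ∎
        where open ≡-Reasoning
      ... | no j₀≢j = trans (proj₂ rest j) (cong suffix (lookup∘updateAt′ j j₀ (j₀≢j ∘ sym) σ))

partitionable⇔drains : ∀ n k (w : List (Move k)) → Partitionable n k w ⇔ Drains (initialOccupancy n) w
partitionable⇔drains n k w = mk⇔
  (λ (c , parts) → staged⇒drains w c σ₀ (λ j → trans (parts j) (at-start j)) (hist-replicate n))
  (λ d → let c , staged = drains⇒staged d σ₀ (hist-replicate n)
         in  c , λ j → trans (staged j) (sym (at-start j)))
  where
    σ₀ = replicate n 0
    at-start : ∀ j → allFin (suc k) ≡ suffix (lookup σ₀ j)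
    at-start j = cong suffix (sym (lookup-replicate j 0))

lemma1 : (n k : ℕ) (w : List (Move k)) →
    (Complete n k w ⇔ Partitionable n k w) × (Partitionable n k w ⇔ Ballot n k w)
lemma1 n k w =
    ⇔-trans (complete⇔drains n k w) (⇔-sym (partitionable⇔drains n k w))
  , ⇔-trans (partitionable⇔drains n k w) (⇔-sym (ballot⇔drains n k w))
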